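{- (i) If either $d=3$ and $\ell\ge 4$, or $d\ge 3$ and $\ell=2$, then the subKautz digraph $sK(d,\ell)$ has diameter $2\ell$. (ii) The subKautz digraph $sK(3,3)$ has diameter $5$.
   Context: $sK(d,\ell)$ is the digraph whose vertices are the words $x_1x_2\ldots x_\ell$ over $\mathbb{Z}_{d+1}$ with $x_i\neq x_{i+1}$ for $i=1,\dots,\ell-1$, with arcs $x_1x_2\ldots x_\ell\to x_2\ldots x_\ell x_{\ell+1}$ for every $x_{\ell+1}\in\mathbb{Z}_{d+1}$ with $x_{\ell+1}\neq x_1,x_\ell$. The diameter is the maximum directed distance between ordered pairs of vertices. -}

module Defs where

open import Data.Nat using (ℕ; zero; suc; _≤_)
open import Data.Fin using (Fin)
open import Data.Vec using (Vec; []; _∷_; head; tail; last; _∷ʳ_)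
open import Data.Product using (Σ; Σ-syntax; ∃; ∃-syntax; _×_; _,_; proj₁)
open import Data.Unit using (⊤)
open import Data.Empty using (⊥)
open import Relation.Binary.PropositionalEquality using (_≡_; _≢_)

Word : ℕ → ℕ → Set
Word d ℓ = Vec (Fin (suc d)) ℓ

AdjDistinct : ∀ {A : Set} {n} → Vec A n → Set
AdjDistinct [] = ⊤
AdjDistinct (x ∷ []) = ⊤
AdjDistinct (x ∷ y ∷ xs) = x ≢ y × AdjDistinct (y ∷ xs)

Vertex : ℕ → ℕ → Set
Vertex d ℓ = Σ (Word d ℓ) AdjDistinct

-- Arcs x₁…x_ℓ → x₂…x_ℓ x_{ℓ+1} with x_{ℓ+1} ≠ x₁, x_ℓ  (only meaningful for ℓ ≥ 1).
ArcW : ∀ d ℓ → Word d ℓ → Word d ℓ → Set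
ArcW d zero u v = ⊥
ArcW d (suc n) u v =
  Σ[ y ∈ Fin (suc d) ] (v ≡ tail u ∷ʳ y) × (y ≢ head u) × (y ≢ last u)

Arc : ∀ d ℓ → Vertex d ℓ → Vertex d ℓ → Set
Arc d ℓ u v = ArcW d ℓ (proj₁ u) (proj₁ v)

data Walk (d ℓ : ℕ) : ℕ → Vertex d ℓ → Vertex d ℓ → Set where
  here : ∀ {u} → Walk d ℓ 0 u u
  step : ∀ {k u v w} → Arc d ℓ u v → Walk d ℓ k v w → Walk d ℓ (suc k) u w

HasDiameter : ℕ → ℕ → ℕ → Set
HasDiameter d ℓ D =
  ((u v : Vertex d ℓ) → ∃[ k ] (k ≤ D × Walk d ℓ k u v))
  × (∃[ u ] ∃[ v ] ((k : ℕ) → Walk d ℓ k u v → D ≤ k))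

-- A walk of length k between two vertices of sK(d, ℓ) is the same as a word of k + ℓ letters
-- that starts with the first vertex, ends with the second, has distinct consecutive letters and
-- in which every letter differs from the one ℓ places earlier.
--
-- Upper bound 2ℓ: between u and v one inserts ℓ letters, each avoiding its predecessor and the
-- letters of u and v standing ℓ places before and after it. With d + 1 ≥ 5 letters this greedy
-- choice always works. With 4 letters a choice may be forced; reading the alphabet as (ℤ/2)²,
-- a forced letter is the sum of the three excluded ones, and if the insertion of ℓ letters is
-- forced to fail, so that the last one meets v₀, then inserting ℓ - 1 letters (a walk of
-- length 2ℓ - 1) cannot also be forced to fail: the two forced sums would force u_{ℓ-1} = v₀,
-- which the first failure excludes.
--
-- Lower bound 2ℓ (d = 3, ℓ ≥ 4): explicit pairs of words, made of the alternating word
-- c0 c1 c0 … and a few letters c2, c3, for which every length k < 2ℓ makes some letter clash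
-- with its predecessor or with the letter ℓ places before it. In the hardest case the inserted
-- letters are pinned to alternate between c2 and c3 and run into the target word. The pairs
-- c0 c1 / c1 c0 and c0 c1 c0 / c1 c2 c0 give the lower bounds for ℓ = 2 and for sK(3, 3),
-- whose upper bound 5 is an exhaustive check.

module Submission where

open import Defs
open import Data.Nat
open import Data.Nat.Properties
open import Data.Fin as F using (Fin; toℕ)
import Data.Fin.Properties as Finₚ
-- Vec's constructors stay qualified: with an ambiguous _∷_ in scope the ring solver's lists of
-- variables no longer elaborate.
open import Data.Vec as Vec using (Vec; head; tail; last; _∷ʳ_; lookup)
open import Data.Vec.Properties using (∷ʳ-injective; last-∷ʳ)
open import Data.Product
open import Data.Sum using (_⊎_; inj₁; inj₂)
open import Data.Unit using (tt)
open import Data.Empty using (⊥; ⊥-elim)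
open import Function using (_∘_)
open import Relation.Binary.PropositionalEquality
open import Relation.Binary.Definitions using (tri<; tri≈; tri>)
open import Relation.Nullary using (¬_; Dec; yes; no; contradiction; ¬?; _→-dec_; _×-dec_; _⊎-dec_)
open import Relation.Nullary.Decidable using (toWitness)
open import Data.List using ([]; _∷_)
open import Data.Nat.Tactic.RingSolver using (solve)

private variable
  A : Set
  d : ℕ

pattern c0 = F.zero
pattern c1 = F.suc c0
pattern c2 = F.suc c1
pattern c3 = F.suc c2

split-at : ∀ b q → q < b ⊎ ∃[ o ] q ≡ b + o
split-at b q with q <? b
... | yes q<b = inj₁ q<b
... | no  q≮b = let o , b+o≡q = m≤n⇒∃[o]m+o≡n (≮⇒≥ q≮b) in inj₂ (o , sym b+o≡q)

<-by : ∀ {a b} r → suc (a + r) ≡ b → a < b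
<-by {a} r refl = s≤s (m≤m+n a r)

≤-by : ∀ {a b} r → a + r ≡ b → a ≤ b
≤-by {a} r refl = m≤m+n a r

≮-by : ∀ {a b} → a < b → ∀ r → b + r ≡ a → ⊥
≮-by {b = b} a<b r refl = <⇒≱ a<b (m≤m+n b r)

even-or-odd : ∀ j → (∃[ t ] j ≡ 2 * t) ⊎ (∃[ t ] j ≡ suc (2 * t))
even-or-odd zero = inj₁ (0 , refl)
even-or-odd (suc j) with even-or-odd j
... | inj₁ (t , refl) = inj₂ (t , refl)
... | inj₂ (t , refl) = inj₁ (suc t , sym (*-suc 2 t))

window : (ℕ → A) → (n : ℕ) → Vec A n
window z zero    = Vec.[]
window z (suc n) = z 0 Vec.∷ window (z ∘ suc) n

window-∷ʳ : ∀ (z : ℕ → A) n → window z (suc n) ≡ window z n ∷ʳ z n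
window-∷ʳ z zero    = refl
window-∷ʳ z (suc n) = cong (z 0 Vec.∷_) (window-∷ʳ (z ∘ suc) n)

last-window : ∀ (z : ℕ → A) n → last (window z (suc n)) ≡ z n
last-window z n = trans (cong last (window-∷ʳ z n)) (last-∷ʳ (z n) (window z n))

window-agree : ∀ (f g : ℕ → A) n → window f n ≡ window g n → ∀ {i} → i < n → f i ≡ g i
window-agree f g (suc n) eq {zero}  _         = cong head eq
window-agree f g (suc n) eq {suc i} (s≤s i<n) = window-agree (f ∘ suc) (g ∘ suc) n (cong tail eq) i<n

window-cong : ∀ (f g : ℕ → A) n → (∀ {i} → i < n → f i ≡ g i) → window f n ≡ window g n
window-cong f g zero    _  = refl
window-cong f g (suc n) fg = cong₂ Vec._∷_ (fg z<s) (window-cong (f ∘ suc) (g ∘ suc) n (fg ∘ s<s))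

pad : ∀ {n} → A → Vec A n → ℕ → A
pad a Vec.[]       _       = a
pad a (b Vec.∷ _)  zero    = b
pad a (_ Vec.∷ bs) (suc i) = pad a bs i

window-pad : ∀ {n} (a : A) (w : Vec A n) → window (pad a w) n ≡ w
window-pad a Vec.[]       = refl
window-pad a (b Vec.∷ bs) = cong (b Vec.∷_) (window-pad a bs)

head-∷-tail : ∀ {n} (w : Vec A (suc n)) {ws} → tail w ≡ ws → w ≡ head w Vec.∷ ws
head-∷-tail (a Vec.∷ as) refl = refl

splice : ℕ → (ℕ → A) → (ℕ → A) → ℕ → A
splice zero    f g         = g
splice (suc L) f g zero    = f 0
splice (suc L) f g (suc i) = splice L (f ∘ suc) g i

splice-left : ∀ L (f g : ℕ → A) {i} → i < L → splice L f g i ≡ f i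
splice-left (suc L) f g {zero}  _         = refl
splice-left (suc L) f g {suc i} (s≤s i<L) = splice-left L (f ∘ suc) g i<L

splice-right : ∀ L (f g : ℕ → A) {p i} → L + i ≡ p → splice L f g p ≡ g i
splice-right zero    f g refl = refl
splice-right (suc L) f g refl = splice-right L (f ∘ suc) g refl

AdjDistinct⇒adjacent : ∀ (z : ℕ → A) n → AdjDistinct (window z n) → ∀ {q} → suc q < n → z (suc q) ≢ z q
AdjDistinct⇒adjacent z (suc zero)    _            {zero}  (s≤s ())
AdjDistinct⇒adjacent z (suc (suc n)) (z0≢z1 , _) {zero}  _          = z0≢z1 ∘ sym
AdjDistinct⇒adjacent z (suc (suc n)) (_ , rest)  {suc q} (s≤s q<n) =
  AdjDistinct⇒adjacent (z ∘ suc) (suc n) rest q<n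

adjacent⇒AdjDistinct : ∀ (z : ℕ → A) n → (∀ {q} → suc q < n → z (suc q) ≢ z q) → AdjDistinct (window z n)
adjacent⇒AdjDistinct z zero          _   = tt
adjacent⇒AdjDistinct z (suc zero)    _   = tt
adjacent⇒AdjDistinct z (suc (suc n)) adj =
  adj (s≤s (s≤s z≤n)) ∘ sym , adjacent⇒AdjDistinct (z ∘ suc) (suc n) (adj ∘ s≤s)

vertex : ∀ (z : ℕ → Fin (suc d)) ℓ → (∀ {q} → suc q < ℓ → z (suc q) ≢ z q) → Vertex d ℓ
vertex z ℓ adj = window z ℓ , adjacent⇒AdjDistinct z ℓ adj

letters : ∀ {ℓ} → Vertex d ℓ → ℕ → Fin (suc d)
letters u = pad c0 (proj₁ u)

window-letters : ∀ {ℓ} (u : Vertex d ℓ) → proj₁ u ≡ window (letters u) ℓ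
window-letters u = sym (window-pad c0 (proj₁ u))

letters-adjacent : ∀ {ℓ} (u : Vertex d ℓ) → ∀ {q} → suc q < ℓ → letters u (suc q) ≢ letters u q
letters-adjacent {ℓ = ℓ} u = AdjDistinct⇒adjacent (letters u) ℓ (subst AdjDistinct (window-letters u) (proj₂ u))

-- Walks as spellings

-- The letters of a walk of length k whose end vertices have the words f and g: adjacent is the
-- arc condition x_{ℓ+1} ≠ x_ℓ and no-return the arc condition x_{ℓ+1} ≠ x_1.
record Spelling (d ℓ k : ℕ) (f g : ℕ → Fin (suc d)) : Set where
  field
    letter    : ℕ → Fin (suc d)
    source    : ∀ {i} → i < ℓ → letter i ≡ f i
    target    : ∀ {i} → i < ℓ → letter (k + i) ≡ g i
    adjacent  : ∀ {q} → suc q < k + ℓ → letter (suc q) ≢ letter q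
    no-return : ∀ {s} → s < k → letter (s + ℓ) ≢ letter s

module _ {n k : ℕ} {f g : ℕ → Fin (suc d)} (u : Vertex d (suc n))
         (u≡f : proj₁ u ≡ window f (suc n)) (S : Spelling d (suc n) (suc k) f g) where
  open Spelling S

  private
    u≡letter : proj₁ u ≡ window letter (suc n)
    u≡letter = trans u≡f (window-cong f letter (suc n) (sym ∘ source))

  second-vertex : Vertex d (suc n)
  second-vertex = vertex (letter ∘ suc) (suc n) (λ q<ℓ → adjacent (≤-trans (s≤s q<ℓ) (s≤s (m≤n+m (suc n) k))))

  first-arc : ∀ w → proj₁ w ≡ window (letter ∘ suc) (suc n) → Arc d (suc n) u w
  first-arc w w≡ =
    letter (suc n)
    , trans w≡ (trans (window-∷ʳ (letter ∘ suc) n) (cong (_∷ʳ letter (suc n)) (cong tail (sym u≡letter))))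
    , (λ eq → no-return z<s (trans eq (cong head u≡letter)))
    , (λ eq → adjacent (s≤s (m≤n+m (suc n) k)) (trans eq (trans (cong last u≡letter) (last-window letter n))))

  rest-spelling : Spelling d (suc n) k (letter ∘ suc) g
  rest-spelling = record
    { letter    = letter ∘ suc
    ; source    = λ _ → refl
    ; target    = target
    ; adjacent  = adjacent ∘ s≤s
    ; no-return = no-return ∘ s≤s
    }

spelling⇒walk : ∀ {n k f g} {u v : Vertex d (suc n)} → proj₁ u ≡ window f (suc n) → proj₁ v ≡ window g (suc n) →
                Spelling d (suc n) (suc k) f g → Walk d (suc n) (suc k) u v
spelling⇒walk {n = n} {zero} {g = g} {u} {v} u≡f v≡g S =
  step (first-arc u u≡f S v (trans v≡g (window-cong g _ (suc n) (sym ∘ Spelling.target S)))) here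
spelling⇒walk {k = suc k} {u = u} {v} u≡f v≡g S =
  step {v = second-vertex u u≡f S} (first-arc u u≡f S (second-vertex u u≡f S) refl)
       (spelling⇒walk {f = Spelling.letter S ∘ suc} {v = v} refl v≡g (rest-spelling u u≡f S))

walk⇒spelling : ∀ {n k} {u v : Vertex d (suc n)} → Walk d (suc n) k u v → Spelling d (suc n) k (letters u) (letters v)
walk⇒spelling {n = n} {u = u} here = record
  { letter    = letters u
  ; source    = λ _ → refl
  ; target    = λ _ → refl
  ; adjacent  = letters-adjacent u
  ; no-return = λ ()
  }
walk⇒spelling {d} {n} {k = suc k} {u} (step {v = w} (y , w≡ , y≢head , y≢last) walk) = record
  { letter    = z
  ; source    = window-agree z (letters u) (suc n) (trans (sym u≡z) (window-letters u))
  ; target    = Spelling.target S′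
  ; adjacent  = adjacent
  ; no-return = no-return
  }
  where
  S′ = walk⇒spelling walk
  z′ = Spelling.letter S′
  w≡z′ : proj₁ w ≡ window z′ (suc n)
  w≡z′ = trans (window-letters w) (window-cong (letters w) z′ (suc n) (sym ∘ Spelling.source S′))
  z : ℕ → Fin (suc d)
  z zero    = head (proj₁ u)
  z (suc i) = z′ i
  split : tail (proj₁ u) ≡ window z′ n × y ≡ z′ n
  split = ∷ʳ-injective _ _ (trans (sym w≡) (trans w≡z′ (window-∷ʳ z′ n)))
  u≡z : proj₁ u ≡ window z (suc n)
  u≡z = head-∷-tail (proj₁ u) (proj₁ split)
  adjacent : ∀ {q} → suc q < suc k + suc n → z (suc q) ≢ z q
  adjacent {q} q< with <-cmp q n
  ... | tri< q<n _ _  = AdjDistinct⇒adjacent z (suc n) (subst AdjDistinct u≡z (proj₂ u)) (s≤s q<n)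
  ... | tri≈ _ refl _ = λ eq →
    y≢last (trans (proj₂ split) (trans eq (trans (sym (last-window z n)) (cong last (sym u≡z)))))
  ... | tri> _ _ n<q  = later n<q q<
    where
    later : ∀ {q} → n < q → suc q < suc k + suc n → z (suc q) ≢ z q
    later {suc q} _ (s≤s q<) = Spelling.adjacent S′ q<
  no-return : ∀ {s} → s < suc k → z (s + suc n) ≢ z s
  no-return {zero}  _         eq = y≢head (trans (proj₂ split) eq)
  no-return {suc s} (s≤s s<k) = Spelling.no-return S′ s<k

module _ {ℓ k : ℕ} {f g : ℕ → Fin (suc d)} (S : Spelling d ℓ k f g) where
  open Spelling S

  overlap-agrees : ∀ i → k + i < ℓ → g i ≡ f (k + i)
  overlap-agrees i k+i<ℓ = trans (sym (target (≤-trans (s≤s (m≤n+m i k)) k+i<ℓ))) (source k+i<ℓ)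

  returns-before-target : ∀ s i → s + ℓ ≡ k + i → i < ℓ → s < k
  returns-before-target s i s+ℓ≡k+i i<ℓ = +-cancelʳ-< ℓ s k (subst (_< k + ℓ) (sym s+ℓ≡k+i) (+-monoʳ-< k i<ℓ))

  target-differs : ∀ s i → s + ℓ ≡ k + i → i < ℓ → g i ≢ letter s
  target-differs s i s+ℓ≡k+i i<ℓ gᵢ≡ = no-return (returns-before-target s i s+ℓ≡k+i i<ℓ)
    (trans (cong letter s+ℓ≡k+i) (trans (target i<ℓ) gᵢ≡))

  return-clash : ∀ s i → s + ℓ ≡ k + i → s < ℓ → i < ℓ → g i ≢ f s
  return-clash s i s+ℓ≡k+i s<ℓ i<ℓ gᵢ≡fₛ = target-differs s i s+ℓ≡k+i i<ℓ (trans gᵢ≡fₛ (sym (source s<ℓ)))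

  adjacent-clash : ∀ q i → suc q ≡ k + i → q < ℓ → i < ℓ → g i ≢ f q
  adjacent-clash q i q+1≡k+i q<ℓ i<ℓ gᵢ≡f_q =
    adjacent (subst (_< k + ℓ) (sym q+1≡k+i) (+-monoʳ-< k i<ℓ))
      (trans (cong letter q+1≡k+i) (trans (target i<ℓ) (trans gᵢ≡f_q (sym (source q<ℓ)))))

respell : ∀ {ℓ k} {f f′ g g′ : ℕ → Fin (suc d)} → (∀ {i} → i < ℓ → f i ≡ f′ i) → (∀ {i} → i < ℓ → g i ≡ g′ i) →
          Spelling d ℓ k f g → Spelling d ℓ k f′ g′
respell f≗ g≗ S = record
  { letter    = letter
  ; source    = λ i<ℓ → trans (source i<ℓ) (f≗ i<ℓ)
  ; target    = λ i<ℓ → trans (target i<ℓ) (g≗ i<ℓ)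
  ; adjacent  = adjacent
  ; no-return = no-return
  }
  where open Spelling S

FarPair : ℕ → ℕ → ℕ → Set
FarPair d ℓ D = ∃[ u ] ∃[ v ] ∀ k → Walk d ℓ k u v → D ≤ k

walks-at-least : ∀ {n D} {f g : ℕ → Fin (suc d)} (u v : Vertex d (suc n)) →
                 proj₁ u ≡ window f (suc n) → proj₁ v ≡ window g (suc n) →
                 (∀ k → Spelling d (suc n) k f g → D ≤ k) → ∀ k → Walk d (suc n) k u v → D ≤ k
walks-at-least {n = n} {f = f} {g} u v u≡f v≡g far k walk =
  far k (respell (window-agree (letters u) f (suc n) (trans (sym (window-letters u)) u≡f))
                 (window-agree (letters v) g (suc n) (trans (sym (window-letters v)) v≡g))
                 (walk⇒spelling walk))

-- Bridges and the upper bound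

avoid : ∀ {r} → r ≤ d → (h : Fin r → Fin (suc d)) → ∃[ e ] ∀ j → e ≢ h j
avoid {d} {r} r≤d h =
  let e , missed = Finₚ.¬∀⟶∃¬ (suc d) (λ e → ∃[ j ] h j ≡ e) (λ e → Finₚ.any? λ j → h j Finₚ.≟ e) not-onto
  in e , λ j e≡hⱼ → missed (j , sym e≡hⱼ)
  where
  not-onto : ¬ (∀ e → ∃[ j ] h j ≡ e)
  not-onto onto with Finₚ.pigeonhole (s≤s r≤d) (proj₁ ∘ onto)
  ... | i , j , i<j , same =
    <-irrefl (cong toℕ (trans (sym (proj₂ (onto i))) (trans (cong h same) (proj₂ (onto j))))) i<j

avoid-three : 3 ≤ d → ∀ (a b c : Fin (suc d)) → ∃[ e ] e ≢ a × e ≢ b × e ≢ c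
avoid-three 3≤d a b c =
  let e , fresh = avoid 3≤d (lookup (a Vec.∷ b Vec.∷ c Vec.∷ Vec.[])) in e , fresh c0 , fresh c1 , fresh c2

avoid-four : 4 ≤ d → ∀ (a b c c′ : Fin (suc d)) → ∃[ e ] e ≢ a × e ≢ b × e ≢ c × e ≢ c′
avoid-four 4≤d a b c c′ =
  let e , fresh = avoid 4≤d (lookup (a Vec.∷ b Vec.∷ c Vec.∷ c′ Vec.∷ Vec.[])) in
  e , fresh c0 , fresh c1 , fresh c2 , fresh c3

avoid-repeated : 3 ≤ d → ∀ {a b r : Fin (suc d)} → a ≡ b ⊎ a ≡ r ⊎ b ≡ r → ∀ c →
                 ∃[ e ] e ≢ a × e ≢ b × e ≢ r × e ≢ c
avoid-repeated 3≤d {a} {r = r} (inj₁ refl) c =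
  let e , e≢a , e≢r , e≢c = avoid-three 3≤d a r c in e , e≢a , e≢a , e≢r , e≢c
avoid-repeated 3≤d {a} {b} (inj₂ (inj₁ refl)) c =
  let e , e≢a , e≢b , e≢c = avoid-three 3≤d a b c in e , e≢a , e≢b , e≢a , e≢c
avoid-repeated 3≤d {a} {b} (inj₂ (inj₂ refl)) c =
  let e , e≢a , e≢b , e≢c = avoid-three 3≤d a b c in e , e≢a , e≢b , e≢b , e≢c

distinct-or-repeated : ∀ (a b r : Fin (suc d)) → (a ≢ b × a ≢ r × b ≢ r) ⊎ (a ≡ b ⊎ a ≡ r ⊎ b ≡ r)
distinct-or-repeated a b r with a Finₚ.≟ b | a Finₚ.≟ r | b Finₚ.≟ r
... | yes a≡b | _       | _       = inj₂ (inj₁ a≡b)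
... | no  _   | yes a≡r | _       = inj₂ (inj₂ (inj₁ a≡r))
... | no  _   | no  _   | yes b≡r = inj₂ (inj₂ (inj₂ b≡r))
... | no  a≢b | no  a≢r | no  b≢r = inj₁ (a≢b , a≢r , b≢r)

Bridge : (a b m : ℕ → Fin (suc d)) → ℕ → Set
Bridge a b m L = ∀ {i} → i < L → m (suc i) ≢ a i × m (suc i) ≢ b i × m (suc i) ≢ m i

BridgeAvoiding : (a b : ℕ → Fin (suc d)) → Fin (suc d) → ℕ → Fin (suc d) → Set
BridgeAvoiding a b p L c = ∃[ m ] m 0 ≡ p × Bridge a b m L × m L ≢ c

extended : (ℕ → A) → ℕ → A → ℕ → A
extended m L e = splice (suc L) m (λ _ → e)

extended-end : ∀ (m : ℕ → A) L e → extended m L e (suc L) ≡ e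
extended-end m L e = splice-right (suc L) m _ (+-identityʳ (suc L))

extend : ∀ {a b m : ℕ → Fin (suc d)} {L e} → Bridge a b m L → e ≢ a L → e ≢ b L → e ≢ m L →
         Bridge a b (extended m L e) (suc L)
extend {a = a} {b} {m} {L} {e} bridge e≢a e≢b e≢m {i} (s≤s i≤L) with m≤n⇒m<n∨m≡n i≤L
... | inj₁ i<L  = subst₂ (λ f g → f ≢ a i × f ≢ b i × f ≢ g)
                    (sym (splice-left (suc L) m _ (s≤s i<L))) (sym (splice-left (suc L) m _ (m<n⇒m<1+n i<L)))
                    (bridge i<L)
... | inj₂ refl = subst₂ (λ f g → f ≢ a i × f ≢ b i × f ≢ g)
                    (sym (extended-end m L e)) (sym (splice-left (suc L) m _ (n<1+n i)))
                    (e≢a , e≢b , e≢m)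

-- The word x₀ … x_{n-1} m₀ m₁ … m_L y₀ y₁ …, with m₀ = x_n, has length ℓ + L + ℓ for ℓ = n + 1 = δ + L.
-- In it m_{i+1} stands ℓ places after x_i and ℓ places before y_{δ+i}, and y_j with j < δ
-- stands ℓ places after x_{L+j}.
module _ {n : ℕ} {x y m : ℕ → Fin (suc d)} (δ L : ℕ)
         (x-adjacent : ∀ {q} → suc q < suc n → x (suc q) ≢ x q)
         (y-adjacent : ∀ {q} → suc q < suc n → y (suc q) ≢ y q)
         (δ+L≡ℓ : δ + L ≡ suc n) (m₀≡x : m 0 ≡ x n) (bridge : Bridge x (λ j → y (δ + j)) m L)
         (arrive : y 0 ≢ m L) (skip : ∀ {j} → j < δ → y j ≢ x (L + j)) where

  private
    z : ℕ → Fin (suc d)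
    z = splice n x (splice (suc L) m y)

    L≤ℓ : L ≤ suc n
    L≤ℓ = subst (L ≤_) δ+L≡ℓ (m≤n+m L δ)

    z-source : ∀ {i} → i < suc n → z i ≡ x i
    z-source {i} i<ℓ with split-at n i
    ... | inj₁ i<n        = splice-left n x _ i<n
    ... | inj₂ (o , refl) with o | i<ℓ
    ...   | zero  | _ = trans (splice-right n x _ refl) (trans m₀≡x (cong x (sym (+-identityʳ n))))
    ...   | suc o | lt = ⊥-elim (<⇒≱ (m<m+n n z<s) (≤-pred lt))

    z-bridge : ∀ {i} → i ≤ L → z (n + i) ≡ m i
    z-bridge i≤L = trans (splice-right n x _ refl) (splice-left (suc L) m y (s≤s i≤L))

    z-target : ∀ j → z (n + (suc L + j)) ≡ y j
    z-target j = trans (splice-right n x _ refl) (splice-right (suc L) m y refl)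

    arrival : ∀ j → suc n + L + j ≡ n + (suc L + j)
    arrival j = solve (n ∷ L ∷ j ∷ [])

    z-arrival : z (suc (n + L)) ≡ y 0
    z-arrival = trans (cong z eq) (z-target 0)
      where
      eq : suc (n + L) ≡ n + (suc L + 0)
      eq = solve (n ∷ L ∷ [])

    source-adjacent : ∀ {q} → suc q < suc n → z (suc q) ≢ z q
    source-adjacent q<ℓ rewrite z-source q<ℓ | z-source (<⇒≤ q<ℓ) = x-adjacent q<ℓ

    adjacent : ∀ {q} → suc q < suc n + L + suc n → z (suc q) ≢ z q
    adjacent {q} q< with split-at n q
    ... | inj₁ q<n        = source-adjacent (s≤s q<n)
    ... | inj₂ (i , refl) with <-cmp i L
    ...   | tri< i<L _ _  = subst₂ _≢_ (sym (trans (cong z (sym (+-suc n i))) (z-bridge i<L)))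
                                   (sym (z-bridge (<⇒≤ i<L))) (proj₂ (proj₂ (bridge i<L)))
    ...   | tri≈ _ refl _ = subst₂ _≢_ (sym z-arrival) (sym (z-bridge ≤-refl)) arrive
    ...   | tri> _ _ L<i  with split-at (suc L) i
    ...     | inj₁ i≤L         = ⊥-elim (<-irrefl refl (≤-trans L<i (≤-pred i≤L)))
    ...     | inj₂ (j , refl)  =
      subst₂ _≢_ (sym (trans (cong z shift) (z-target (suc j)))) (sym (z-target j))
             (y-adjacent (+-cancelˡ-< (n + suc L) (suc j) (suc n) bound))
      where
      shift : suc (n + (suc L + j)) ≡ n + (suc L + suc j)
      shift = solve (n ∷ L ∷ j ∷ [])
      bound : n + suc L + suc j < n + suc L + suc n
      bound = subst₂ _<_ lhs rhs q<
        where
        rhs : suc n + L + suc n ≡ n + suc L + suc n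
        rhs = solve (n ∷ L ∷ [])
        lhs : suc (n + (suc L + j)) ≡ n + suc L + suc j
        lhs = solve (n ∷ L ∷ j ∷ [])

    no-return : ∀ {s} → s < suc n + L → z (s + suc n) ≢ z s
    no-return {s} s< with split-at L s
    ... | inj₁ s<L = subst₂ _≢_ (sym (trans (cong z (trans (+-comm s (suc n)) (sym (+-suc n s)))) (z-bridge s<L)))
                                (sym (z-source (<-≤-trans s<L L≤ℓ)))
                                (proj₁ (bridge s<L))
    ... | inj₂ (j , refl) with split-at δ j
    ...   | inj₁ j<δ        = subst₂ _≢_ (sym (trans (cong z moved) (z-target j))) (sym (z-source inside)) (skip j<δ)
      where
      moved : L + j + suc n ≡ n + (suc L + j)
      moved = solve (L ∷ j ∷ n ∷ [])
      inside : L + j < suc n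
      inside = subst (L + j <_) (trans (+-comm L δ) δ+L≡ℓ) (+-monoʳ-< L j<δ)
    ...   | inj₂ (i , refl) = subst₂ _≢_ (sym (trans (cong z moved) (z-target (δ + i))))
                                         (sym (trans (cong z middle) (z-bridge i<L)))
                                         (≢-sym (proj₁ (proj₂ (bridge i<L))))
      where
      moved : L + (δ + i) + suc n ≡ n + (suc L + (δ + i))
      moved = solve (L ∷ δ ∷ i ∷ n ∷ [])
      regroup : L + (δ + i) ≡ δ + L + i
      regroup = solve (L ∷ δ ∷ i ∷ [])
      middle : L + (δ + i) ≡ n + suc i
      middle = trans regroup (trans (cong (_+ i) δ+L≡ℓ) (sym (+-suc n i)))
      i<L : i < L
      i<L = +-cancelˡ-< (suc n) i L (subst (_< suc n + L) (trans regroup (cong (_+ i) δ+L≡ℓ)) s<)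

  bridge⇒spelling : Spelling d (suc n) (suc n + L) x y
  bridge⇒spelling = record
    { letter    = z
    ; source    = z-source
    ; target    = λ {j} _ → trans (cong z (arrival j)) (z-target j)
    ; adjacent  = adjacent
    ; no-return = no-return
    }

module _ (4≤d : 4 ≤ d) (a b : ℕ → Fin (suc d)) (p : Fin (suc d)) where

  greedy-bridge : ∀ L → ∃[ m ] m 0 ≡ p × Bridge a b m L
  greedy-bridge-avoiding : ∀ L c → BridgeAvoiding a b p (suc L) c

  greedy-bridge zero    = (λ _ → p) , refl , λ ()
  greedy-bridge (suc L) = let m , m₀ , bridge , _ = greedy-bridge-avoiding L p in m , m₀ , bridge

  greedy-bridge-avoiding L c with greedy-bridge L
  ... | m , m₀ , bridge with avoid-four 4≤d (a L) (b L) (m L) c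
  ...   | e , e≢a , e≢b , e≢m , e≢c =
    extended m L e , m₀ , extend bridge e≢a e≢b e≢m , subst (_≢ c) (sym (extended-end m L e)) e≢c

walk-of-length-2ℓ : 4 ≤ d → ∀ n (u v : Vertex d (suc n)) → Walk d (suc n) (suc n + suc n) u v
walk-of-length-2ℓ 4≤d n u v =
  let m , m₀ , bridge , arrive = greedy-bridge-avoiding 4≤d x y (x n) n (y 0) in
  spelling⇒walk (window-letters u) (window-letters v)
    (bridge⇒spelling 0 (suc n) (letters-adjacent u) (letters-adjacent v) refl m₀ bridge (≢-sym arrive) λ ())
  where
  x = letters u
  y = letters v

-- Four letters

F4 : Set
F4 = Fin 4

-- Bitwise exclusive or of the two-digit binary numerals 0, 1, 2, 3: this makes F4 the group
-- (ℤ/2)², in which any three distinct letters add up to the fourth one.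
infixl 6 _⊕_
_⊕_ : F4 → F4 → F4
c0 ⊕ b  = b
c1 ⊕ c0 = c1
c1 ⊕ c1 = c0
c1 ⊕ c2 = c3
c1 ⊕ c3 = c2
c2 ⊕ c0 = c2
c2 ⊕ c1 = c3
c2 ⊕ c2 = c0
c2 ⊕ c3 = c1
c3 ⊕ c0 = c3
c3 ⊕ c1 = c2
c3 ⊕ c2 = c1
c3 ⊕ c3 = c0

⊕-assoc : ∀ a b c → a ⊕ b ⊕ c ≡ a ⊕ (b ⊕ c)
⊕-assoc = toWitness {a? = Finₚ.all? λ a → Finₚ.all? λ b → Finₚ.all? λ c → a ⊕ b ⊕ c Finₚ.≟ a ⊕ (b ⊕ c)} tt

⊕-exchange : ∀ w a b c → w ⊕ a ⊕ b ⊕ c ≡ w ⊕ c ⊕ b ⊕ a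
⊕-exchange = toWitness {a? = Finₚ.all? λ w → Finₚ.all? λ a → Finₚ.all? λ b → Finₚ.all? λ c →
                                w ⊕ a ⊕ b ⊕ c Finₚ.≟ w ⊕ c ⊕ b ⊕ a} tt

⊕-sandwich : ∀ a b → a ⊕ b ⊕ a ≡ b
⊕-sandwich = toWitness {a? = Finₚ.all? λ a → Finₚ.all? λ b → a ⊕ b ⊕ a Finₚ.≟ b} tt

fourth-letter : ∀ a b c e → a ≢ b → a ≢ c → b ≢ c → e ≢ a → e ≢ b → e ≢ c → e ≡ a ⊕ b ⊕ c
fourth-letter = toWitness {a? = Finₚ.all? λ a → Finₚ.all? λ b → Finₚ.all? λ c → Finₚ.all? λ e →
  ¬? (a Finₚ.≟ b) →-dec ¬? (a Finₚ.≟ c) →-dec ¬? (b Finₚ.≟ c) →-dec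
  ¬? (e Finₚ.≟ a) →-dec ¬? (e Finₚ.≟ b) →-dec ¬? (e Finₚ.≟ c) →-dec e Finₚ.≟ a ⊕ b ⊕ c} tt

fourth-letter-fresh : ∀ a b c → a ≢ b → a ≢ c → b ≢ c → a ⊕ b ⊕ c ≢ a × a ⊕ b ⊕ c ≢ b × a ⊕ b ⊕ c ≢ c
fourth-letter-fresh = toWitness {a? = Finₚ.all? λ a → Finₚ.all? λ b → Finₚ.all? λ c →
  ¬? (a Finₚ.≟ b) →-dec ¬? (a Finₚ.≟ c) →-dec ¬? (b Finₚ.≟ c) →-dec
  ¬? (a ⊕ b ⊕ c Finₚ.≟ a) ×-dec ¬? (a ⊕ b ⊕ c Finₚ.≟ b) ×-dec ¬? (a ⊕ b ⊕ c Finₚ.≟ c)} tt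

module Forcing (a b : ℕ → F4) (p : F4) where

  forced-end : ℕ → F4
  forced-end zero    = p
  forced-end (suc L) = forced-end L ⊕ a L ⊕ b L

  -- Either a bridge of length L can end away from any given letter, or there is one ending at
  -- forced-end L (and, in fact, every one does).
  data Ends (L : ℕ) : Set where
    free   : (∀ c → BridgeAvoiding a b p L c) → Ends L
    forced : ∃[ m ] m 0 ≡ p × Bridge a b m L × m L ≡ forced-end L → Ends L

  ends : ∀ L → Ends L
  ends zero = forced ((λ _ → p) , refl , (λ ()) , refl)
  ends (suc L) with ends L
  ... | free avoiding = free λ c →
    let e , e≢a , e≢b , e≢c = avoid-three ≤-refl (a L) (b L) c
        m , m₀ , bridge , m≢e = avoiding e
    in extended m L e , m₀ , extend bridge e≢a e≢b (≢-sym m≢e) , subst (_≢ c) (sym (extended-end m L e)) e≢c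
  ... | forced (m , m₀ , bridge , m≡end) with distinct-or-repeated (m L) (a L) (b L)
  ...   | inj₁ (m≢a , m≢b , a≢b) =
    let e≢m , e≢a , e≢b = fourth-letter-fresh (m L) (a L) (b L) m≢a m≢b a≢b in
    forced (extended m L _ , m₀ , extend bridge e≢a e≢b e≢m ,
            trans (extended-end m L _) (cong (λ f → f ⊕ a L ⊕ b L) m≡end))
  ...   | inj₂ repeated = free λ c →
    let e , e≢m , e≢a , e≢b , e≢c = avoid-repeated ≤-refl repeated c in
    extended m L e , m₀ , extend bridge e≢a e≢b e≢m , subst (_≢ c) (sym (extended-end m L e)) e≢c

  bridge-or-forced : ∀ L c → BridgeAvoiding a b p (suc L) c ⊎ (forced-end (suc L) ≡ c × a L ≢ c)
  bridge-or-forced L c with ends (suc L)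
  ... | free avoiding = inj₁ (avoiding c)
  ... | forced (m , m₀ , bridge , m≡end) with m (suc L) Finₚ.≟ c
  ...   | no  m≢c = inj₁ (m , m₀ , bridge , m≢c)
  ...   | yes m≡c = inj₂ (trans (sym m≡end) m≡c , λ a≡c → proj₁ (bridge ≤-refl) (trans m≡c (sym a≡c)))

forced-end-shift : ∀ (x y : ℕ → F4) p L →
  Forcing.forced-end x y p (suc L) ≡ Forcing.forced-end x (y ∘ suc) p L ⊕ x L ⊕ y 0
forced-end-shift x y p zero    = refl
forced-end-shift x y p (suc L) = begin
  Forcing.forced-end x y p (suc L) ⊕ x (suc L) ⊕ y (suc L)
    ≡⟨ cong (λ f → f ⊕ x (suc L) ⊕ y (suc L)) (forced-end-shift x y p L) ⟩
  Forcing.forced-end x (y ∘ suc) p L ⊕ x L ⊕ y 0 ⊕ x (suc L) ⊕ y (suc L)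
    ≡⟨ ⊕-exchange _ (y 0) (x (suc L)) (y (suc L)) ⟩
  Forcing.forced-end x (y ∘ suc) p L ⊕ x L ⊕ y (suc L) ⊕ x (suc L) ⊕ y 0 ∎
  where open ≡-Reasoning

module _ (n : ℕ) (u v : Vertex 3 (2 + n)) where
  private
    x y : ℕ → F4
    x = letters u
    y = letters v

    twice : 2 + n + (2 + n) ≡ 2 * (2 + n)
    twice = solve (n ∷ [])
    once-less : suc (2 + n + suc n) ≡ 2 * (2 + n)
    once-less = solve (n ∷ [])

  walk-within-2ℓ : ∃[ k ] k ≤ 2 * (2 + n) × Walk 3 (2 + n) k u v
  walk-within-2ℓ with Forcing.bridge-or-forced x y (x (suc n)) (suc n) (y 0)
  ... | inj₁ (m , m₀ , bridge , arrive) =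
    _ , ≤-reflexive twice ,
    spelling⇒walk (window-letters u) (window-letters v)
      (bridge⇒spelling 0 (2 + n) (letters-adjacent u) (letters-adjacent v) refl m₀ bridge (≢-sym arrive) λ ())
  ... | inj₂ (long-forced , x≢y₀) with Forcing.bridge-or-forced x (y ∘ suc) (x (suc n)) n (y 0)
  ...   | inj₁ (m , m₀ , bridge , arrive) =
    _ , ≤-trans (n≤1+n _) (≤-reflexive once-less) ,
    spelling⇒walk (window-letters u) (window-letters v)
      (bridge⇒spelling 1 (suc n) (letters-adjacent u) (letters-adjacent v) refl m₀ bridge (≢-sym arrive) skip)
    where
    skip : ∀ {j} → j < 1 → y j ≢ x (suc n + j)
    skip z<s = ≢-sym (subst (λ i → x i ≢ y 0) (sym (+-identityʳ (suc n))) x≢y₀)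
  ...   | inj₂ (short-forced , _) = ⊥-elim (x≢y₀ (begin
    x (suc n)
      ≡⟨ ⊕-sandwich (y 0) (x (suc n)) ⟨
    y 0 ⊕ x (suc n) ⊕ y 0
      ≡⟨ cong (λ f → f ⊕ x (suc n) ⊕ y 0) short-forced ⟨
    Forcing.forced-end x (y ∘ suc) (x (suc n)) (suc n) ⊕ x (suc n) ⊕ y 0
      ≡⟨ forced-end-shift x y (x (suc n)) (suc n) ⟨
    Forcing.forced-end x y (x (suc n)) (2 + n)
      ≡⟨ long-forced ⟩
    y 0 ∎))
    where open ≡-Reasoning

-- Lower bounds

module _ {d : ℕ} where
  private
    ab ba : Vertex (suc d) 2
    ab = (c0 Vec.∷ c1 Vec.∷ Vec.[]) , (λ ()) , tt
    ba = (c1 Vec.∷ c0 Vec.∷ Vec.[]) , (λ ()) , tt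

    far : ∀ k → Spelling (suc d) 2 k (letters ab) (letters ba) → 4 ≤ k
    far 0 S = contradiction (overlap-agrees S 0 z<s) λ ()
    far 1 S = ⊥-elim (return-clash S 0 1 refl z<s (s<s z<s) refl)
    far 2 S = ⊥-elim (adjacent-clash S 1 0 refl (s<s z<s) z<s refl)
    far 3 S = ⊥-elim (return-clash S 1 0 refl (s<s z<s) z<s refl)
    far (suc (suc (suc (suc k)))) _ = s≤s (s≤s (s≤s (s≤s z≤n)))

  far-pair-ℓ2 : FarPair (suc d) 2 (2 * 2)
  far-pair-ℓ2 = ab , ba , walks-at-least ab ba (window-letters ab) (window-letters ba) far

alt : ℕ → F4
alt 0             = c0
alt 1             = c1
alt (suc (suc i)) = alt i

alt-suc : ∀ i → alt (suc i) ≡ c1 ⊕ alt i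
alt-suc 0             = refl
alt-suc 1             = refl
alt-suc (suc (suc i)) = alt-suc i

alt-even : ∀ t → alt (2 * t) ≡ c0
alt-even zero    = refl
alt-even (suc t) = trans (cong alt (*-suc 2 t)) (alt-even t)

alt-odd : ∀ t → alt (suc (2 * t)) ≡ c1
alt-odd t = trans (alt-suc (2 * t)) (cong (c1 ⊕_) (alt-even t))

alt-shift : ∀ r i → alt (2 * r + i) ≡ alt i
alt-shift zero    i = refl
alt-shift (suc r) i = trans (cong alt (cong (_+ i) (*-suc 2 r))) (alt-shift r i)

alt-low : ∀ i → alt i ≡ c0 ⊎ alt i ≡ c1
alt-low 0             = inj₁ refl
alt-low 1             = inj₂ refl
alt-low (suc (suc i)) = alt-low i

alt≢c2 : ∀ i → alt i ≢ c2
alt≢c2 i with alt-low i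
... | inj₁ eq rewrite eq = λ ()
... | inj₂ eq rewrite eq = λ ()

alt-adjacent : ∀ i → alt (suc i) ≢ alt i
alt-adjacent i rewrite alt-suc i with alt-low i
... | inj₁ eq rewrite eq = λ ()
... | inj₂ eq rewrite eq = λ ()

avoids-alt-pair : ∀ {e} i → e ≢ alt i → e ≢ alt (suc i) → e ≢ c0 × e ≢ c1
avoids-alt-pair i e≢ e≢′ rewrite alt-suc i with alt-low i
... | inj₁ eq rewrite eq = e≢ , e≢′
... | inj₂ eq rewrite eq = e≢′ , e≢

-- Outside {c0, c1} the only way to change letter is to swap c2 and c3, i.e. to add c1.
alternation : ∀ (w : ℕ → F4) L → w 0 ≢ c0 → w 0 ≢ c1 →
              (∀ {i} → i < L → w (suc i) ≢ c0 × w (suc i) ≢ c1 × w (suc i) ≢ w i) →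
              ∀ {i} → i ≤ L → w i ≡ alt i ⊕ w 0
alternation w L w₀≢c0 w₀≢c1 moves {i = zero}  _   = refl
alternation w L w₀≢c0 w₀≢c1 moves {i = suc i} i<L = begin
  w (suc i)          ≡⟨ fourth-letter c0 c1 (w i) (w (suc i)) (λ ()) (≢-sym wᵢ≢c0) (≢-sym wᵢ≢c1) e≢c0 e≢c1 e≢wᵢ ⟩
  c1 ⊕ w i           ≡⟨ cong (c1 ⊕_) (alternation w L w₀≢c0 w₀≢c1 moves (<⇒≤ i<L)) ⟩
  c1 ⊕ (alt i ⊕ w 0) ≡⟨ ⊕-assoc c1 (alt i) (w 0) ⟨
  c1 ⊕ alt i ⊕ w 0   ≡⟨ cong (_⊕ w 0) (alt-suc i) ⟨
  alt (suc i) ⊕ w 0  ∎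
  where
  open ≡-Reasoning
  e≢c0 = proj₁ (moves i<L)
  e≢c1 = proj₁ (proj₂ (moves i<L))
  e≢wᵢ = proj₂ (proj₂ (moves i<L))
  low-free : ∀ {i} → i < L → w i ≢ c0 × w i ≢ c1
  low-free {zero}  _   = w₀≢c0 , w₀≢c1
  low-free {suc i} i<L = proj₁ (moves (<-trans (n<1+n i) i<L)) , proj₁ (proj₂ (moves (<-trans (n<1+n i) i<L)))
  wᵢ≢c0 = proj₁ (low-free i<L)
  wᵢ≢c1 = proj₂ (low-free i<L)

-- even-source M = (c0 c1)ᴹ c0 c2 and even-target = c2 (c0 c1)ᴹ c0, as words of length 2M + 2.
even-source : ℕ → ℕ → F4
even-source M = splice (suc (2 * M)) alt (λ _ → c2)

even-target : ℕ → F4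
even-target = splice 1 (λ _ → c2) alt

even-source-alt : ∀ M {i} → i < suc (2 * M) → even-source M i ≡ alt i
even-source-alt M = splice-left (suc (2 * M)) alt _

even-source-last : ∀ M → even-source M (suc (2 * M)) ≡ c2
even-source-last M = splice-right (suc (2 * M)) alt _ (+-identityʳ _)

even-source-adjacent : ∀ M {q} → suc q < 2 + 2 * M → even-source M (suc q) ≢ even-source M q
even-source-adjacent M {q} (s≤s q+1≤n) with m≤n⇒m<n∨m≡n q+1≤n
... | inj₁ q+1<n  rewrite even-source-alt M q+1<n | even-source-alt M (<-trans (n<1+n q) q+1<n) = alt-adjacent q
... | inj₂ refl   rewrite even-source-last M | even-source-alt M (n<1+n q) = ≢-sym (alt≢c2 q)

even-target-adjacent : ∀ q → even-target (suc q) ≢ even-target q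
even-target-adjacent zero    = λ ()
even-target-adjacent (suc q) = alt-adjacent q

module _ (t r : ℕ) where
  private
    M n ℓ L k : ℕ
    M = suc (t + r)
    n = suc (2 * M)
    ℓ = suc n
    L = 2 + 2 * t
    k = n + suc L

    L<n : L < n
    L<n = <-by (2 * r) eq
      where
      eq : suc (2 + 2 * t + 2 * r) ≡ suc (2 * suc (t + r))
      eq = solve (t ∷ r ∷ [])

    ℓ≡ : 2 + 2 * r + L ≡ ℓ
    ℓ≡ = eq
      where
      eq : 2 + 2 * r + (2 + 2 * t) ≡ 2 + 2 * suc (t + r)
      eq = solve (t ∷ r ∷ [])

    n+L<k+ℓ : suc (n + L) < k + ℓ
    n+L<k+ℓ = <-by n eq
      where
      eq : suc (suc (suc (2 * suc (t + r)) + (2 + 2 * t)) + suc (2 * suc (t + r)))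
         ≡ suc (2 * suc (t + r)) + suc (2 + 2 * t) + suc (suc (2 * suc (t + r)))
      eq = solve (t ∷ r ∷ [])

    early-position : L + ℓ ≡ n + L + 1
    early-position = eq
      where
      eq : 2 + 2 * t + (2 + 2 * suc (t + r)) ≡ suc (2 * suc (t + r)) + (2 + 2 * t) + 1
      eq = solve (t ∷ r ∷ [])

    target-position : ∀ i → i + ℓ + ℓ ≡ k + (2 + 2 * r + i)
    target-position i = eq
      where
      eq : i + (2 + 2 * suc (t + r)) + (2 + 2 * suc (t + r)) ≡ suc (2 * suc (t + r)) + (3 + 2 * t) + (2 + 2 * r + i)
      eq = solve (t ∷ r ∷ i ∷ [])

  even-early-return : Spelling 3 ℓ (n + L) (even-source M) even-target → ⊥
  even-early-return S =
    return-clash S L 1 early-position (m<n⇒m<1+n L<n) (s<s z<s) (sym (trans (even-source-alt M L<n) (alt-even t)))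

  -- The letters between the two words avoid the pair {c0, c1} seen ℓ places before and after
  -- them, so from c2 on they alternate between c2 and c3, and after an even number of steps
  -- they are back at c2 just where even-target must start with c2.
  even-chain : Spelling 3 ℓ k (even-source M) even-target → ⊥
  even-chain S = adjacent n+L<k+ℓ (trans (cong letter arrive) (trans (target z<s) (sym wL≡c2)))
    where
    open Spelling S
    w : ℕ → F4
    w i = letter (n + i)
    arrive : suc (n + L) ≡ k + 0
    arrive = trans (sym (+-suc n L)) (sym (+-identityʳ k))
    w₀≡c2 : w 0 ≡ c2
    w₀≡c2 = trans (cong letter (+-identityʳ n)) (trans (source (n<1+n n)) (even-source-last M))
    w-suc : ∀ i → letter (i + ℓ) ≡ w (suc i)
    w-suc i = cong letter (trans (+-comm i ℓ) (sym (+-suc n i)))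
    moves : ∀ {i} → i < L → w (suc i) ≢ c0 × w (suc i) ≢ c1 × w (suc i) ≢ w i
    moves {i} i<L = let ≢c0 , ≢c1 = avoids-alt-pair i ≢alt ≢alt-next in ≢c0 , ≢c1 , ≢previous
      where
      i<n : i < n
      i<n = <-trans i<L L<n
      ≢alt : w (suc i) ≢ alt i
      ≢alt eq = no-return (<-≤-trans i<L (≤-trans (n≤1+n L) (m≤n+m (suc L) n)))
        (trans (w-suc i) (trans eq (sym (trans (source (m<n⇒m<1+n i<n)) (even-source-alt M i<n)))))
      ≢alt-next : w (suc i) ≢ alt (suc i)
      ≢alt-next eq = target-differs S (i + ℓ) (2 + 2 * r + i) (target-position i)
        (<-≤-trans (+-monoʳ-< (2 + 2 * r) i<L) (≤-reflexive ℓ≡))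
        (trans (cong alt (sym (+-suc (2 * r) i))) (trans (alt-shift r (suc i)) (trans (sym eq) (sym (w-suc i)))))
      ≢previous : w (suc i) ≢ w i
      ≢previous = subst (_≢ w i) (cong letter (sym (+-suc n i))) (adjacent (<-trans (s≤s (+-monoʳ-< n i<L)) n+L<k+ℓ))
    wL≡c2 : w L ≡ c2
    wL≡c2 = trans (alternation w L (subst (_≢ c0) (sym w₀≡c2) λ ()) (subst (_≢ c1) (sym w₀≡c2) λ ()) moves ≤-refl)
                  (trans (cong (_⊕ w 0) (alt-even t)) w₀≡c2)

-- The target word starts at position k: inside or right after the source word, where a letter
-- clashes directly, or after a gap of j = k - ℓ > 0 letters, which clashes at once when j is odd
-- and is even-chain when j is even.
even-short : ∀ M k → Spelling 3 (2 + 2 * M) k (even-source M) even-target → ¬ (k < 2 * (2 + 2 * M))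
even-short M k S k<2ℓ with split-at (suc (2 * M)) k
... | inj₁ k<n =
  alt≢c2 k (sym (trans (overlap-agrees S 0 k+0<ℓ) (trans (cong (even-source M) (+-identityʳ k)) (even-source-alt M k<n))))
  where
  k+0<ℓ : k + 0 < 2 + 2 * M
  k+0<ℓ = subst (_< 2 + 2 * M) (sym (+-identityʳ k)) (m<n⇒m<1+n k<n)
... | inj₂ (0 , refl) = return-clash S 0 1 eq z<s (s<s z<s) refl
  where
  eq : 0 + (2 + 2 * M) ≡ suc (2 * M) + 0 + 1
  eq = solve (M ∷ [])
... | inj₂ (1 , refl) = adjacent-clash S (suc (2 * M)) 0 eq (n<1+n _) z<s (sym (even-source-last M))
  where
  eq : suc (suc (2 * M)) ≡ suc (2 * M) + 1 + 0
  eq = solve (M ∷ [])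
... | inj₂ (suc (suc j) , refl) with even-or-odd j
...   | inj₁ (t , refl) with split-at M t
...     | inj₁ t<M with m≤n⇒∃[o]m+o≡n t<M
...       | r , refl = even-early-return t r S
even-short M k S k<2ℓ | inj₂ (suc (suc j) , refl) | inj₁ (t , refl) | inj₂ (0 , refl) =
  return-clash S (suc (2 * M)) 0 eq (n<1+n _) z<s (sym (even-source-last M))
  where
  eq : suc (2 * M) + (2 + 2 * M) ≡ suc (2 * M) + (2 + 2 * (M + 0)) + 0
  eq = solve (M ∷ [])
even-short M k S k<2ℓ | inj₂ (suc (suc j) , refl) | inj₁ (t , refl) | inj₂ (suc o , refl) =
  ≮-by k<2ℓ (1 + 2 * o) eq
  where
  eq : 2 * (2 + 2 * M) + (1 + 2 * o) ≡ suc (2 * M) + (2 + 2 * (M + suc o))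
  eq = solve (M ∷ o ∷ [])
even-short M k S k<2ℓ | inj₂ (suc (suc j) , refl) | inj₂ (t , refl) with split-at M t
... | inj₁ t<M with m≤n⇒∃[o]m+o≡n t<M
...   | r , refl = even-chain t r S
even-short M k S k<2ℓ | inj₂ (suc (suc j) , refl) | inj₂ (t , refl) | inj₂ (o , refl) =
  ≮-by k<2ℓ (2 * o) eq
  where
  eq : 2 * (2 + 2 * M) + 2 * o ≡ suc (2 * M) + (2 + suc (2 * (M + o)))
  eq = solve (M ∷ o ∷ [])

far-pair-even : ∀ M → FarPair 3 (2 + 2 * M) (2 * (2 + 2 * M))
far-pair-even M = u , v , walks-at-least u v refl refl (λ k S → ≮⇒≥ (even-short M k S))
  where
  u v : Vertex 3 (2 + 2 * M)
  u = vertex (even-source M) (2 + 2 * M) (even-source-adjacent M)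
  v = vertex even-target (2 + 2 * M) (λ {q} _ → even-target-adjacent q)

-- odd-source e = (c0 c1)ᵉ⁺¹ c0 c2 c1 and odd-target e = c1 c2 c3 (c0 c1)ᵉ c0 c2, as words of
-- length 2e + 5.
odd-source : ℕ → ℕ → F4
odd-source e = splice (3 + 2 * e) alt (splice 1 (λ _ → c2) (λ _ → c1))

odd-head : ℕ → F4
odd-head 0                   = c1
odd-head 1                   = c2
odd-head 2                   = c3
odd-head (suc (suc (suc i))) = alt i

odd-target : ℕ → ℕ → F4
odd-target e = splice (4 + 2 * e) odd-head (λ _ → c2)

odd-source-alt : ∀ e {i} → i < 3 + 2 * e → odd-source e i ≡ alt i
odd-source-alt e = splice-left (3 + 2 * e) alt _

odd-source-c2 : ∀ e → odd-source e (3 + 2 * e) ≡ c2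
odd-source-c2 e = splice-right (3 + 2 * e) alt _ (+-identityʳ _)

odd-source-c1 : ∀ e → odd-source e (4 + 2 * e) ≡ c1
odd-source-c1 e = splice-right (3 + 2 * e) alt _ (+-comm (3 + 2 * e) 1)

odd-target-head : ∀ e {i} → i < 4 + 2 * e → odd-target e i ≡ odd-head i
odd-target-head e = splice-left (4 + 2 * e) odd-head _

odd-target-c2 : ∀ e → odd-target e (4 + 2 * e) ≡ c2
odd-target-c2 e = splice-right (4 + 2 * e) odd-head _ (+-identityʳ _)

odd-source-adjacent : ∀ e {q} → suc q < 5 + 2 * e → odd-source e (suc q) ≢ odd-source e q
odd-source-adjacent e {q} (s≤s q+1≤n) with m≤n⇒m<n∨m≡n q+1≤n
... | inj₂ refl rewrite odd-source-c1 e | odd-source-c2 e = λ ()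
... | inj₁ (s≤s q+1≤) with m≤n⇒m<n∨m≡n q+1≤
...   | inj₂ refl rewrite odd-source-c2 e | odd-source-alt e (n<1+n q) = ≢-sym (alt≢c2 q)
...   | inj₁ q+1<  rewrite odd-source-alt e q+1< | odd-source-alt e (<-trans (n<1+n q) q+1<) = alt-adjacent q

odd-head-adjacent : ∀ q → odd-head (suc q) ≢ odd-head q
odd-head-adjacent 0                   = λ ()
odd-head-adjacent 1                   = λ ()
odd-head-adjacent 2                   = λ ()
odd-head-adjacent (suc (suc (suc q))) = alt-adjacent q

odd-target-adjacent : ∀ e {q} → suc q < 5 + 2 * e → odd-target e (suc q) ≢ odd-target e q
odd-target-adjacent e {q} (s≤s q+1≤n) with m≤n⇒m<n∨m≡n q+1≤n
... | inj₁ q+1<n rewrite odd-target-head e q+1<n | odd-target-head e (<-trans (n<1+n q) q+1<n) = odd-head-adjacent q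
... | inj₂ refl  rewrite odd-target-c2 e | odd-target-head e (n<1+n q) = ≢-sym (alt≢c2 (2 * e))

module _ (t r : ℕ) where
  private
    e ℓ : ℕ
    e = t + r
    ℓ = 5 + 2 * e

    overlap-position : suc (2 * t) + 1 ≡ 2 + 2 * t
    overlap-position = +-comm (suc (2 * t)) 1

    even-inside : 2 + 2 * t < 3 + 2 * e
    even-inside = <-by (2 * r) eq
      where
      eq : suc (2 + 2 * t + 2 * r) ≡ 3 + 2 * (t + r)
      eq = solve (t ∷ r ∷ [])

    odd-inside : 1 + 2 * t < 3 + 2 * e
    odd-inside = <-trans (n<1+n _) even-inside

    early-position : 1 + 2 * t + ℓ ≡ 3 + 2 * e + (3 + 2 * t) + 0
    early-position = eq
      where
      eq : 1 + 2 * t + (5 + 2 * (t + r)) ≡ 3 + 2 * (t + r) + (3 + 2 * t) + 0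
      eq = solve (t ∷ r ∷ [])

  odd-overlap : Spelling 3 ℓ (suc (2 * t)) (odd-source e) (odd-target e) → ⊥
  odd-overlap S = contradiction
    (trans (overlap-agrees S 1 (<-trans (subst (_< 3 + 2 * e) (sym overlap-position) even-inside)
                                        (<-trans (n<1+n _) (n<1+n _))))
      (trans (cong (odd-source e) overlap-position) (trans (odd-source-alt e even-inside) (alt-even t))))
    λ ()

  odd-early-return : Spelling 3 ℓ (3 + 2 * e + (3 + 2 * t)) (odd-source e) (odd-target e) → ⊥
  odd-early-return S =
    return-clash S (1 + 2 * t) 0 early-position (<-trans odd-inside (<-trans (n<1+n _) (n<1+n _))) z<s
      (sym (trans (odd-source-alt e odd-inside) (alt-odd t)))

module _ (t r : ℕ) where
  private
    e ℓ : ℕ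
    e = suc (t + r)
    ℓ = 5 + 2 * e

    late-position : 4 + 2 * e + ℓ ≡ 3 + 2 * e + (3 + suc (2 * t)) + (4 + 2 * r)
    late-position = eq
      where
      eq : 4 + 2 * suc (t + r) + (5 + 2 * suc (t + r)) ≡ 3 + 2 * suc (t + r) + (3 + suc (2 * t)) + (4 + 2 * r)
      eq = solve (t ∷ r ∷ [])

    inside : 4 + 2 * r < 4 + 2 * e
    inside = <-by (suc (2 * t)) eq
      where
      eq : suc (4 + 2 * r + suc (2 * t)) ≡ 4 + 2 * suc (t + r)
      eq = solve (t ∷ r ∷ [])

  odd-late-return : Spelling 3 ℓ (3 + 2 * e + (3 + suc (2 * t))) (odd-source e) (odd-target e) → ⊥
  odd-late-return S =
    return-clash S (4 + 2 * e) (4 + 2 * r) late-position (n<1+n _) (<-trans inside (n<1+n _))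
      (trans (odd-target-head e inside) (trans (alt-odd r) (sym (odd-source-c1 e))))

module _ (e : ℕ) where
  private
    ℓ k : ℕ
    ℓ = 5 + 2 * e
    k = 3 + 2 * e + (3 + 2 * suc e)

    first-position : 0 + ℓ + ℓ ≡ k + 2
    first-position = eq
      where
      eq : 0 + (5 + 2 * e) + (5 + 2 * e) ≡ 3 + 2 * e + (3 + 2 * suc e) + 2
      eq = solve (e ∷ [])

    middle-position : ∀ i → suc i + ℓ + ℓ ≡ k + (3 + i)
    middle-position i = eq
      where
      eq : suc i + (5 + 2 * e) + (5 + 2 * e) ≡ 3 + 2 * e + (3 + 2 * suc e) + (3 + i)
      eq = solve (e ∷ i ∷ [])

    last-position : 2 + 2 * e + ℓ + ℓ ≡ k + (4 + 2 * e)
    last-position = eq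
      where
      eq : 2 + 2 * e + (5 + 2 * e) + (5 + 2 * e) ≡ 3 + 2 * e + (3 + 2 * suc e) + (4 + 2 * e)
      eq = solve (e ∷ [])

    arrival : suc (2 + 2 * e + ℓ) ≡ k + 0
    arrival = eq
      where
      eq : suc (2 + 2 * e + (5 + 2 * e)) ≡ 3 + 2 * e + (3 + 2 * suc e) + 0
      eq = solve (e ∷ [])

    middle<k : ∀ {i} → i ≤ 2 + 2 * e → suc i < k
    middle<k i≤ = s≤s (s≤s (≤-trans i≤ (≤-by (2 + 2 * suc e) eq)))
      where
      eq : 2 + 2 * e + (2 + 2 * suc e) ≡ suc (2 * e + (3 + 2 * suc e))
      eq = solve (e ∷ [])

    middle+ℓ<k+ℓ : ∀ {i} → i ≤ 2 + 2 * e → suc (i + ℓ) < k + ℓ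
    middle+ℓ<k+ℓ i≤ = +-monoˡ-< ℓ (middle<k i≤)

  -- The letters between the two words start with the fourth letter c2 and then avoid the pair
  -- {c0, c1} seen ℓ places before and after them, so they alternate between c2 and c3; the
  -- last one must then be c1, where odd-target must start with c1.
  odd-chain : Spelling 3 ℓ k (odd-source e) (odd-target e) → ⊥
  odd-chain S = adjacent (middle+ℓ<k+ℓ ≤-refl) (trans (cong letter arrival) (trans (target z<s) (sym last≡c1)))
    where
    open Spelling S
    w : ℕ → F4
    w i = letter (i + ℓ)
    source-alt : ∀ {i} → i < 3 + 2 * e → letter i ≡ alt i
    source-alt i< = trans (source (<-trans i< (<-trans (n<1+n _) (n<1+n _)))) (odd-source-alt e i<)
    returns : ∀ {i} → i ≤ 2 + 2 * e → w i ≢ letter i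
    returns i≤ = no-return (<-trans (n<1+n _) (middle<k i≤))
    adjacent-middle : ∀ {i} → i < 2 + 2 * e → w (suc i) ≢ w i
    adjacent-middle i< = adjacent (middle+ℓ<k+ℓ (<⇒≤ i<))
    w₀≡c2 : w 0 ≡ c2
    w₀≡c2 = fourth-letter c0 c3 c1 (w 0) (λ ()) (λ ()) (λ ()) ≢c0 ≢c3 ≢c1
      where
      ≢c0 : w 0 ≢ c0
      ≢c0 eq = returns z≤n (trans eq (sym (source z<s)))
      ≢c3 : w 0 ≢ c3
      ≢c3 eq = target-differs S (0 + ℓ) 2 first-position (s<s (s<s z<s)) (sym eq)
      ≢c1 : w 0 ≢ c1
      ≢c1 eq = adjacent (<-trans (n<1+n ℓ) (middle+ℓ<k+ℓ z≤n))
                        (trans eq (sym (trans (source (n<1+n _)) (odd-source-c1 e))))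
    moves : ∀ {i} → i < suc (2 * e) → w (suc i) ≢ c0 × w (suc i) ≢ c1 × w (suc i) ≢ w i
    moves {i} i< =
      let ≢c0 , ≢c1 = avoids-alt-pair i ≢alt ≢alt-next in ≢c0 , ≢c1 , adjacent-middle (<-trans i< (n<1+n _))
      where
      ≢alt-next : w (suc i) ≢ alt (suc i)
      ≢alt-next eq = returns (s≤s (<⇒≤ i<)) (trans eq (sym (source-alt (s≤s (<-trans i< (n<1+n _))))))
      ≢alt : w (suc i) ≢ alt i
      ≢alt eq = target-differs S (suc i + ℓ) (3 + i) (middle-position i) (s≤s (s≤s (s≤s (<-trans i< (n<1+n _)))))
        (trans (odd-target-head e (s≤s (s≤s (s≤s i<)))) (sym eq))
    penultimate≡c3 : w (suc (2 * e)) ≡ c3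
    penultimate≡c3 =
      trans (alternation w (suc (2 * e)) (subst (_≢ c0) (sym w₀≡c2) λ ()) (subst (_≢ c1) (sym w₀≡c2) λ ()) moves ≤-refl)
            (trans (cong (_⊕ w 0) (alt-odd e)) (cong (c1 ⊕_) w₀≡c2))
    last≡c1 : w (2 + 2 * e) ≡ c1
    last≡c1 = fourth-letter c0 c2 c3 (w (2 + 2 * e)) (λ ()) (λ ()) (λ ()) ≢c0 ≢c2 ≢c3
      where
      ≢c0 : w (2 + 2 * e) ≢ c0
      ≢c0 eq = returns ≤-refl (trans eq (sym (trans (source-alt (n<1+n _)) (alt-even e))))
      ≢c2 : w (2 + 2 * e) ≢ c2
      ≢c2 eq = target-differs S (2 + 2 * e + ℓ) (4 + 2 * e) last-position (n<1+n _) (trans (odd-target-c2 e) (sym eq))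
      ≢c3 : w (2 + 2 * e) ≢ c3
      ≢c3 eq = adjacent-middle (n<1+n _) (trans eq (sym penultimate≡c3))

-- As for even-short; here a gap of odd length clashes at once except for the gap of length
-- 2e + 3, which is odd-chain, and a gap of even length always clashes at once.
odd-short : ∀ e k → Spelling 3 (5 + 2 * e) k (odd-source e) (odd-target e) → ¬ (k < 2 * (5 + 2 * e))
odd-short e k S k<2ℓ with split-at (3 + 2 * e) k
... | inj₁ k<m with even-or-odd k
...   | inj₁ (t , refl) =
  contradiction
    (trans (overlap-agrees S 0 k+0<ℓ) (trans (cong (odd-source e) (+-identityʳ (2 * t))) (trans (odd-source-alt e k<m) (alt-even t))))
    λ ()
  where
  k+0<ℓ : 2 * t + 0 < 5 + 2 * e
  k+0<ℓ = subst (_< 5 + 2 * e) (sym (+-identityʳ _)) (<-trans k<m (<-trans (n<1+n _) (n<1+n _)))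
...   | inj₂ (t , refl) with split-at (suc e) t
...     | inj₁ t≤e with m≤n⇒∃[o]m+o≡n (≤-pred t≤e)
...       | r , refl = odd-overlap t r S
odd-short e k S k<2ℓ | inj₁ k<m | inj₂ (t , refl) | inj₂ (o , refl) = ≮-by k<m (2 * o) eq
  where
  eq : 3 + 2 * e + 2 * o ≡ suc (2 * (suc e + o))
  eq = solve (e ∷ o ∷ [])
odd-short e k S k<2ℓ | inj₂ (0 , refl) =
  contradiction (trans (overlap-agrees S 0 bound) (splice-right (3 + 2 * e) alt _ (sym (+-identityʳ _)))) λ ()
  where
  bound : 3 + 2 * e + 0 + 0 < 5 + 2 * e
  bound = <-by 1 eq
    where
    eq : suc (3 + 2 * e + 0 + 0 + 1) ≡ 5 + 2 * e
    eq = solve (e ∷ [])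
odd-short e k S k<2ℓ | inj₂ (1 , refl) = return-clash S 2 3 eq (s<s (s<s z<s)) (s<s (s<s (s<s z<s))) refl
  where
  eq : 2 + (5 + 2 * e) ≡ 3 + 2 * e + 1 + 3
  eq = solve (e ∷ [])
odd-short e k S k<2ℓ | inj₂ (2 , refl) = adjacent-clash S (4 + 2 * e) 0 eq (n<1+n _) z<s (sym (odd-source-c1 e))
  where
  eq : suc (4 + 2 * e) ≡ 3 + 2 * e + 2 + 0
  eq = solve (e ∷ [])
odd-short e k S k<2ℓ | inj₂ (suc (suc (suc j)) , refl) with even-or-odd j
... | inj₁ (t , refl) with <-cmp t (suc e)
...   | tri< t≤e _ _ with m≤n⇒∃[o]m+o≡n (≤-pred t≤e)
...     | r , refl = odd-early-return t r S
odd-short e k S k<2ℓ | inj₂ (suc (suc (suc j)) , refl) | inj₁ (t , refl) | tri≈ _ refl _ = odd-chain e S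
odd-short e k S k<2ℓ | inj₂ (suc (suc (suc j)) , refl) | inj₁ (t , refl) | tri> _ _ e<t with m≤n⇒∃[o]m+o≡n e<t
... | o , refl = ≮-by k<2ℓ (2 * o) eq
  where
  eq : 2 * (5 + 2 * e) + 2 * o ≡ 3 + 2 * e + (3 + 2 * (suc (suc e) + o))
  eq = solve (e ∷ o ∷ [])
odd-short e k S k<2ℓ | inj₂ (suc (suc (suc j)) , refl) | inj₂ (t , refl) with <-cmp t e
... | tri< t<e _ _ with m≤n⇒∃[o]m+o≡n t<e
...   | r , refl = odd-late-return t r S
odd-short e k S k<2ℓ | inj₂ (suc (suc (suc j)) , refl) | inj₂ (t , refl) | tri≈ _ refl _ =
  return-clash S (3 + 2 * t) 1 eq (<-trans (n<1+n _) (n<1+n _)) (s<s z<s) (sym (odd-source-c2 t))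
  where
  eq : 3 + 2 * t + (5 + 2 * t) ≡ 3 + 2 * t + (3 + suc (2 * t)) + 1
  eq = solve (t ∷ [])
odd-short e k S k<2ℓ | inj₂ (suc (suc (suc j)) , refl) | inj₂ (t , refl) | tri> _ _ e<t with m≤n⇒∃[o]m+o≡n e<t
... | 0 , refl = return-clash S (4 + 2 * e) 0 eq (n<1+n _) z<s (sym (odd-source-c1 e))
  where
  eq : 4 + 2 * e + (5 + 2 * e) ≡ 3 + 2 * e + (3 + suc (2 * (suc e + 0))) + 0
  eq = solve (e ∷ [])
... | suc o , refl = ≮-by k<2ℓ (1 + 2 * o) eq
  where
  eq : 2 * (5 + 2 * e) + (1 + 2 * o) ≡ 3 + 2 * e + (3 + suc (2 * (suc e + suc o)))
  eq = solve (e ∷ o ∷ [])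

far-pair-odd : ∀ e → FarPair 3 (5 + 2 * e) (2 * (5 + 2 * e))
far-pair-odd e = u , v , walks-at-least u v refl refl (λ k S → ≮⇒≥ (odd-short e k S))
  where
  u v : Vertex 3 (5 + 2 * e)
  u = vertex (odd-source e) (5 + 2 * e) (odd-source-adjacent e)
  v = vertex (odd-target e) (5 + 2 * e) (odd-target-adjacent e)

far-pair-d3 : ∀ ℓ′ → FarPair 3 (4 + ℓ′) (2 * (4 + ℓ′))
far-pair-d3 ℓ′ with even-or-odd ℓ′
... | inj₁ (t , refl) = subst (λ ℓ → FarPair 3 ℓ (2 * ℓ)) (cong (2 +_) (*-suc 2 t)) (far-pair-even (suc t))
... | inj₂ (t , refl) = far-pair-odd t

-- sK(3, 3)

-- The letters z₀ … z_{k+n} spell a walk of length k in sK(3, n + 1).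
Spells : ℕ → ℕ → (ℕ → F4) → Set
Spells n k z = (∀ {q} → q < k + n → z (suc q) ≢ z q) × (∀ {s} → s < k → z (s + suc n) ≢ z s)

spells? : ∀ n k z → Dec (Spells n k z)
spells? n k z =
  allUpTo? (λ q → ¬? (z (suc q) Finₚ.≟ z q)) (k + n) ×-dec allUpTo? (λ s → ¬? (z (s + suc n) Finₚ.≟ z s)) k

spells⇒spelling : ∀ {n k z} → Spells n k z → Spelling 3 (suc n) k z (λ i → z (k + i))
spells⇒spelling {n} {k} (adjacent , no-return) = record
  { letter    = _
  ; source    = λ _ → refl
  ; target    = λ _ → refl
  ; adjacent  = λ {q} q+1<k+ℓ → adjacent (≤-pred (subst (suc q <_) (+-suc k n) q+1<k+ℓ))
  ; no-return = no-return
  }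

-- Any two vertices of sK(3, 3) are joined by a walk of length 3, 4 or 5: a check of the 4⁶
-- pairs of words against the 1 + 4 + 4² candidate spellings.
JoinedWithin5 : F4 → F4 → F4 → F4 → F4 → F4 → Set
JoinedWithin5 a b c a′ b′ c′ =
  Spells 2 3 (pad c0 (a Vec.∷ b Vec.∷ c Vec.∷ a′ Vec.∷ b′ Vec.∷ c′ Vec.∷ Vec.[]))
  ⊎ (∃[ m ] Spells 2 4 (pad c0 (a Vec.∷ b Vec.∷ c Vec.∷ m Vec.∷ a′ Vec.∷ b′ Vec.∷ c′ Vec.∷ Vec.[])))
  ⊎ (∃[ m ] ∃[ m′ ] Spells 2 5 (pad c0 (a Vec.∷ b Vec.∷ c Vec.∷ m Vec.∷ m′ Vec.∷ a′ Vec.∷ b′ Vec.∷ c′ Vec.∷ Vec.[])))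

-- Abstract, so that the cases of walk-within-5 do not unfold the exhaustive check.
abstract
  joined-within-5 : ∀ a b c a′ b′ c′ → a ≢ b → b ≢ c → a′ ≢ b′ → b′ ≢ c′ → JoinedWithin5 a b c a′ b′ c′
  joined-within-5 = toWitness {a? =
    Finₚ.all? λ a → Finₚ.all? λ b → Finₚ.all? λ c → Finₚ.all? λ a′ → Finₚ.all? λ b′ → Finₚ.all? λ c′ →
    ¬? (a Finₚ.≟ b) →-dec ¬? (b Finₚ.≟ c) →-dec ¬? (a′ Finₚ.≟ b′) →-dec ¬? (b′ Finₚ.≟ c′) →-dec
    (spells? 2 3 _ ⊎-dec (Finₚ.any? λ m → spells? 2 4 _) ⊎-dec (Finₚ.any? λ m → Finₚ.any? λ m′ → spells? 2 5 _))} tt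

walk-within-5 : ∀ (u v : Vertex 3 3) → ∃[ k ] k ≤ 5 × Walk 3 3 k u v
walk-within-5 ((a Vec.∷ b Vec.∷ c Vec.∷ Vec.[]) , a≢b , b≢c , _)
              ((a′ Vec.∷ b′ Vec.∷ c′ Vec.∷ Vec.[]) , a′≢b′ , b′≢c′ , _)
  with joined-within-5 a b c a′ b′ c′ a≢b b≢c a′≢b′ b′≢c′
... | inj₁ spells                  = 3 , s≤s (s≤s (s≤s z≤n)) , spelling⇒walk refl refl (spells⇒spelling spells)
... | inj₂ (inj₁ (_ , spells))     = 4 , s≤s (s≤s (s≤s (s≤s z≤n))) , spelling⇒walk refl refl (spells⇒spelling spells)
... | inj₂ (inj₂ (_ , _ , spells)) = 5 , ≤-refl , spelling⇒walk refl refl (spells⇒spelling spells)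

far-pair-sK33 : FarPair 3 3 5
far-pair-sK33 = u , v , walks-at-least u v (window-letters u) (window-letters v) far
  where
  u v : Vertex 3 3
  u = (c0 Vec.∷ c1 Vec.∷ c0 Vec.∷ Vec.[]) , (λ ()) , (λ ()) , tt
  v = (c1 Vec.∷ c2 Vec.∷ c0 Vec.∷ Vec.[]) , (λ ()) , (λ ()) , tt
  far : ∀ k → Spelling 3 3 k (letters u) (letters v) → 5 ≤ k
  far 0 S = contradiction (overlap-agrees S 0 z<s) λ ()
  far 1 S = contradiction (overlap-agrees S 1 (s<s (s<s z<s))) λ ()
  far 2 S = contradiction (overlap-agrees S 0 (s<s (s<s z<s))) λ ()
  far 3 S = ⊥-elim (return-clash S 2 2 refl (s<s (s<s z<s)) (s<s (s<s z<s)) refl)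
  far 4 S = ⊥-elim (return-clash S 1 0 refl (s<s z<s) z<s refl)
  far (suc (suc (suc (suc (suc k))))) _ = s≤s (s≤s (s≤s (s≤s (s≤s z≤n))))

diameter-2ℓ-d3 : ∀ ℓ → 4 ≤ ℓ → HasDiameter 3 ℓ (2 * ℓ)
diameter-2ℓ-d3 _ (s≤s (s≤s (s≤s (s≤s {n = ℓ′} _)))) = walk-within-2ℓ (2 + ℓ′) , far-pair-d3 ℓ′

diameter-2ℓ-ℓ2 : ∀ d → HasDiameter (3 + d) 2 (2 * 2)
diameter-2ℓ-ℓ2 zero    = walk-within-2ℓ 0 , far-pair-ℓ2
diameter-2ℓ-ℓ2 (suc d) =
  (λ u v → 4 , ≤-refl , walk-of-length-2ℓ (s≤s (s≤s (s≤s (s≤s z≤n)))) 1 u v) , far-pair-ℓ2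

mainTheorem7 : ((d ℓ : ℕ) → ((d ≡ 3 × 4 ≤ ℓ) ⊎ (3 ≤ d × ℓ ≡ 2)) → HasDiameter d ℓ (2 * ℓ))
               × HasDiameter 3 3 5
mainTheorem7 = part-i , walk-within-5 , far-pair-sK33
  where
  part-i : (d ℓ : ℕ) → ((d ≡ 3 × 4 ≤ ℓ) ⊎ (3 ≤ d × ℓ ≡ 2)) → HasDiameter d ℓ (2 * ℓ)
  part-i d ℓ (inj₁ (refl , 4≤ℓ)) = diameter-2ℓ-d3 ℓ 4≤ℓ
  part-i _ ℓ (inj₂ (s≤s (s≤s (s≤s {n = d} _)) , refl)) = diameter-2ℓ-ℓ2 d
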